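{- Let $\mathcal{T}$ be an $\mathcal{EL}_\bot$ TBox or a DL-Lite TBox, let $\mathcal{K}=\langle\mathcal{T},\mathcal{A}\rangle$ be an inconsistent knowledge base, and let $\alpha$ be an atomic Boolean instance query with $\mathcal{K}\not\models_{\mathrm{AR}}\alpha$. If $\{\alpha\}$ is not conflict-confining for $\mathcal{K}$, then the AR-abduction problem $\langle\mathcal{K},\alpha\rangle$ has no AR-hypothesis.
   Context: $\mathcal{EL}_\bot$ concepts are built by $C ::= C\sqcap C \mid \exists r.C \mid A \mid \top \mid \bot$; an $\mathcal{EL}_\bot$ TBox is a finite set of concept inclusions $C\sqsubseteq D$. DL-Lite means either DL-Lite$_{\mathcal{R}}$ (concept inclusions $B\sqsubseteq C$ and role inclusions $Q\sqsubseteq S$ with $B::=A\mid\exists Q$, $C::=B\mid\neg B$, $Q::=R\mid R^-$, $S::=Q\mid\neg Q$) or DL-Lite$_{\mathrm{core}}$ (the same without role inclusions). A KB is $\mathcal{K}=\langle\mathcal{T},\mathcal{A}\rangle$ with $\mathcal{A}$ an ABox (finite set of assertions $A(a)$, $r(a,b)$). An ABox $\mathcal{B}$ is $\mathcal{T}$-inconsistent if $\langle\mathcal{T},\mathcal{B}\rangle$ has no model. A repair of $\mathcal{K}$ is a subset-maximal $\mathcal{T}$-consistent subset of $\mathcal{A}$; a conflict is a subset-minimal $\mathcal{T}$-inconsistent subset of $\mathcal{A}$, and $\mathrm{Conf}(\mathcal{K})$ is the set of conflicts. $\mathcal{K}\models_{\mathrm{AR}} q$ iff $\langle\mathcal{T},\mathcal{R}\rangle\models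 q$ for every repair $\mathcal{R}$ of $\mathcal{K}$. An atomic Boolean instance query is $\alpha=A(a)$ with $A$ a concept name and $a$ an individual name. An AR-hypothesis for $\langle\mathcal{K},\alpha\rangle$ is an ABox $\mathcal{H}$ with $\langle\mathcal{T},\mathcal{A}\cup\mathcal{H}\rangle\models_{\mathrm{AR}}\alpha$. An ABox $\mathcal{H}$ is conflict-confining for $\mathcal{K}$ if $\mathrm{Conf}(\langle\mathcal{T},\mathcal{A}\cup\mathcal{H}\rangle)=\mathrm{Conf}(\mathcal{K})$ (equivalently, $\langle\mathcal{T},\mathcal{R}\cup\mathcal{H}\rangle$ is consistent for every repair $\mathcal{R}$ of $\mathcal{K}$). -}

module Defs where

open import Data.Nat using (ℕ)
open import Data.Product using (Σ; _×_; _,_)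
open import Data.Sum using (_⊎_)
open import Data.Unit using (⊤)
open import Data.Empty using (⊥)
open import Data.List using (List; []; _∷_; _++_)
open import Data.List.Relation.Unary.All using (All)
open import Data.List.Relation.Binary.Subset.Propositional using (_⊆_)
open import Relation.Nullary using (¬_)
open import Level using (Level; suc; zero)

ConceptName : Set
ConceptName = ℕ

RoleName : Set
RoleName = ℕ

IndName : Set
IndName = ℕ

record Interpretation : Set₁ where
  field
    Δ    : Set
    cn   : ConceptName → Δ → Set
    rn   : RoleName → Δ → Δ → Set
    ind  : IndName → Δ
    -- non-empty domain is implied by ind

data ELConcept : Set where
  ⊤c   : ELConcept
  ⊥c   : ELConcept
  atom : ConceptName → ELConcept
  _⊓_  : ELConcept → ELConcept → ELConcept
  exists : RoleName → ELConcept → ELConcept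

record ELInclusion : Set where
  constructor _⊑_
  field
    lhs rhs : ELConcept

ELTBox : Set
ELTBox = List ELInclusion

module _ (I : Interpretation) where
  open Interpretation I

  ⟦_⟧EL : ELConcept → Δ → Set
  ⟦ ⊤c ⟧EL d = ⊤
  ⟦ ⊥c ⟧EL d = ⊥
  ⟦ atom A ⟧EL d = cn A d
  ⟦ C ⊓ D ⟧EL d = ⟦ C ⟧EL d × ⟦ D ⟧EL d
  ⟦ exists r C ⟧EL d = Σ Δ λ e → rn r d e × ⟦ C ⟧EL e

  satEL : ELInclusion → Set
  satEL (C ⊑ D) = ∀ d → ⟦ C ⟧EL d → ⟦ D ⟧EL d

-- DL-Lite_R  (DL-Lite_core = DL-Lite_R without role inclusions)

data LRole : Set where
  role : RoleName → LRole
  inv  : RoleName → LRole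

data LRoleRhs : Set where
  posR : LRole → LRoleRhs
  negR : LRole → LRoleRhs

data LBasic : Set where
  atomB : ConceptName → LBasic
  ∃B    : LRole → LBasic

data LConcept : Set where
  posC : LBasic → LConcept
  negC : LBasic → LConcept

data LiteAxiom : Set where
  conceptIncl : LBasic → LConcept → LiteAxiom
  roleIncl    : LRole → LRoleRhs → LiteAxiom

LiteTBox : Set
LiteTBox = List LiteAxiom

IsConceptIncl : LiteAxiom → Set
IsConceptIncl (conceptIncl _ _) = ⊤
IsConceptIncl (roleIncl _ _) = ⊥

module _ (I : Interpretation) where
  open Interpretation I

  ⟦_⟧R : LRole → Δ → Δ → Set
  ⟦ role r ⟧R d e = rn r d e
  ⟦ inv r ⟧R d e = rn r e d

  ⟦_⟧B : LBasic → Δ → Set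
  ⟦ atomB A ⟧B d = cn A d
  ⟦ ∃B Q ⟧B d = Σ Δ λ e → ⟦ Q ⟧R d e

  ⟦_⟧C : LConcept → Δ → Set
  ⟦ posC B ⟧C d = ⟦ B ⟧B d
  ⟦ negC B ⟧C d = ¬ ⟦ B ⟧B d

  ⟦_⟧S : LRoleRhs → Δ → Δ → Set
  ⟦ posR Q ⟧S d e = ⟦ Q ⟧R d e
  ⟦ negR Q ⟧S d e = ¬ ⟦ Q ⟧R d e

  satLite : LiteAxiom → Set
  satLite (conceptIncl B C) = ∀ d → ⟦ B ⟧B d → ⟦ C ⟧C d
  satLite (roleIncl Q S) = ∀ d e → ⟦ Q ⟧R d e → ⟦ S ⟧S d e

data TBox : Set where
  elTBox       : ELTBox → TBox
  liteRTBox    : LiteTBox → TBox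
  liteCoreTBox : (ax : LiteTBox) → All IsConceptIncl ax → TBox

data Assertion : Set where
  conceptAssertion : ConceptName → IndName → Assertion
  roleAssertion    : RoleName → IndName → IndName → Assertion

-- finite set of assertions, represented as a list (set semantics via ⊆)
ABox : Set
ABox = List Assertion

module _ (I : Interpretation) where
  open Interpretation I

  satAssertion : Assertion → Set
  satAssertion (conceptAssertion A a) = cn A (ind a)
  satAssertion (roleAssertion r a b) = rn r (ind a) (ind b)

  ModelOfTBox : TBox → Set
  ModelOfTBox (elTBox T) = All (satEL I) T
  ModelOfTBox (liteRTBox T) = All (satLite I) T
  ModelOfTBox (liteCoreTBox T _) = All (satLite I) T

  ModelOfABox : ABox → Set
  ModelOfABox 𝒜 = All satAssertion 𝒜

IsModel : Interpretation → TBox → ABox → Set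
IsModel I T 𝒜 = ModelOfTBox I T × ModelOfABox I 𝒜

Consistent : TBox → ABox → Set₁
Consistent T 𝒜 = Σ Interpretation λ I → IsModel I T 𝒜

Inconsistent : TBox → ABox → Set₁
Inconsistent T 𝒜 = ¬ Consistent T 𝒜

Entails : TBox → ABox → Assertion → Set₁
Entails T 𝒜 α = ∀ I → IsModel I T 𝒜 → satAssertion I α

IsRepair : TBox → ABox → ABox → Set₁
IsRepair T 𝒜 ℛ =
  ℛ ⊆ 𝒜 × Consistent T ℛ ×
  (∀ ℛ′ → ℛ ⊆ ℛ′ → ℛ′ ⊆ 𝒜 → Consistent T ℛ′ → ℛ′ ⊆ ℛ)

IsConflict : TBox → ABox → ABox → Set₁
IsConflict T 𝒜 𝒞 =
  𝒞 ⊆ 𝒜 × Inconsistent T 𝒞 ×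
  (∀ 𝒞′ → 𝒞′ ⊆ 𝒞 → Inconsistent T 𝒞′ → 𝒞 ⊆ 𝒞′)

ARentails : TBox → ABox → Assertion → Set₁
ARentails T 𝒜 α = ∀ ℛ → IsRepair T 𝒜 ℛ → Entails T ℛ α

-- Conf(⟨T,𝒜 ∪ ℋ⟩) = Conf(⟨T,𝒜⟩)
-- (conflicts are sets of assertions; compared up to set equality ⊆/⊇)
_≐_ : ABox → ABox → Set
ℬ ≐ ℬ′ = ℬ ⊆ ℬ′ × ℬ′ ⊆ ℬ

ConflictConfining : TBox → ABox → ABox → Set₁
ConflictConfining T 𝒜 ℋ =
  (∀ 𝒞 → IsConflict T (𝒜 ++ ℋ) 𝒞 → Σ ABox λ 𝒞′ → IsConflict T 𝒜 𝒞′ × 𝒞 ≐ 𝒞′) ×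
  (∀ 𝒞 → IsConflict T 𝒜 𝒞 → Σ ABox λ 𝒞′ → IsConflict T (𝒜 ++ ℋ) 𝒞′ × 𝒞 ≐ 𝒞′)

IsARHypothesis : TBox → ABox → Assertion → ABox → Set₁
IsARHypothesis T 𝒜 α ℋ = ARentails T (𝒜 ++ ℋ) α

-- Let ℋ be an AR-hypothesis. If α contradicts some T-consistent part 𝒞 of 𝒜,
-- then 𝒞 extends to a repair of 𝒜 ∪ ℋ; that repair entails α, so a model of it
-- is a model of {α} ∪ 𝒞, which is impossible. Otherwise no conflict of 𝒜 ∪ {α}
-- contains α (deleting α from it would leave such a part 𝒞), so 𝒜 ∪ {α} has
-- exactly the conflicts of 𝒜 and {α} is conflict-confining.
-- The goal is always ⊥, so the classical case splits are taken under ¬ ¬.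
module Submission where

open import Defs
open import Data.List using ([]; _∷_; _++_; [_]; filter)
open import Data.List.Membership.Propositional using (_∈_; _∉_)
open import Data.List.Membership.Propositional.Properties using (∈-++⁻; ∈-filter⁺; ∈-filter⁻)
open import Data.List.Relation.Binary.Subset.Propositional using (_⊆_)
open import Data.List.Relation.Binary.Subset.Propositional.Properties
  using (⊆-refl; ⊆-trans; xs⊆x∷xs; ∷⁺ʳ; ∈-∷⁺ʳ; xs⊆xs++ys)
open import Data.List.Relation.Unary.All using (_∷_)
open import Data.List.Relation.Unary.All.Properties using (anti-mono)
open import Data.List.Relation.Unary.Any using (here; there)
import Data.Nat as ℕ
open import Data.Product using (Σ; _×_; _,_; proj₁; proj₂)
open import Data.Sum using (inj₁; inj₂)
open import Function using (_∘_)
open import Relation.Binary.Definitions using (DecidableEquality)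
open import Relation.Binary.PropositionalEquality using (_≢_; refl)
open import Relation.Nullary using (¬_; yes; no; ¬?; contradiction)
open import Relation.Nullary.Decidable using (map′; _×-dec_; ¬¬-excluded-middle)
open import Relation.Nullary.Negation using (¬¬-map)
open import Relation.Unary using (Decidable)

_≟_ : DecidableEquality Assertion
conceptAssertion A a ≟ conceptAssertion B b =
  map′ (λ { (refl , refl) → refl }) (λ { refl → refl , refl }) (A ℕ.≟ B ×-dec a ℕ.≟ b)
conceptAssertion _ _ ≟ roleAssertion _ _ _ = no λ ()
roleAssertion _ _ _ ≟ conceptAssertion _ _ = no λ ()
roleAssertion r a b ≟ roleAssertion s c d =
  map′ (λ { (refl , refl , refl) → refl }) (λ { refl → refl , refl , refl })
       (r ℕ.≟ s ×-dec a ℕ.≟ c ×-dec b ℕ.≟ d)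

∈-++-[]⁻ : ∀ {X : Set} xs {x y : X} → y ∈ xs ++ [ x ] → y ≢ x → y ∈ xs
∈-++-[]⁻ xs y∈ y≢x with ∈-++⁻ xs y∈
... | inj₁ y∈xs = y∈xs
... | inj₂ (here y≡x) = contradiction y≡x y≢x

consistent-antitone : ∀ {T ℬ ℬ′} → ℬ ⊆ ℬ′ → Consistent T ℬ′ → Consistent T ℬ
consistent-antitone ℬ⊆ℬ′ (I , I⊨T , I⊨ℬ′) = I , I⊨T , anti-mono ℬ⊆ℬ′ I⊨ℬ′

module _ (T : TBox) (S : ABox) where

  SaturatingExtension : ABox → ABox → Set₁
  SaturatingExtension xs ℛ = Σ ABox λ ℛ′ →
    ℛ ⊆ ℛ′ × ℛ′ ⊆ S × Consistent T ℛ′ ×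
    (∀ {β} → β ∈ xs → Consistent T (β ∷ ℛ′) → β ∈ ℛ′)

  saturate : ∀ xs ℛ → xs ⊆ S → ℛ ⊆ S → Consistent T ℛ → ¬ ¬ SaturatingExtension xs ℛ
  saturate [] ℛ _ ℛ⊆S cℛ k = k (ℛ , ⊆-refl , ℛ⊆S , cℛ , λ ())
  saturate (x ∷ xs) ℛ x∷xs⊆S ℛ⊆S cℛ k = ¬¬-excluded-middle λ where
      (yes cx∷ℛ) → ¬¬-map accept (saturate xs (x ∷ ℛ) xs⊆S (∈-∷⁺ʳ (x∷xs⊆S (here refl)) ℛ⊆S) cx∷ℛ) k
      (no ¬cx∷ℛ) → ¬¬-map (reject ¬cx∷ℛ) (saturate xs ℛ xs⊆S ℛ⊆S cℛ) k
    where
    xs⊆S : xs ⊆ S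
    xs⊆S = ⊆-trans (xs⊆x∷xs xs x) x∷xs⊆S

    accept : SaturatingExtension xs (x ∷ ℛ) → SaturatingExtension (x ∷ xs) ℛ
    accept (ℛ′ , x∷ℛ⊆ℛ′ , ℛ′⊆S , cℛ′ , saturated) =
      ℛ′ , ⊆-trans (xs⊆x∷xs ℛ x) x∷ℛ⊆ℛ′ , ℛ′⊆S , cℛ′ , λ where
        (here refl) _ → x∷ℛ⊆ℛ′ (here refl)
        (there β∈xs) → saturated β∈xs

    reject : ¬ Consistent T (x ∷ ℛ) → SaturatingExtension xs ℛ → SaturatingExtension (x ∷ xs) ℛ
    reject ¬cx∷ℛ (ℛ′ , ℛ⊆ℛ′ , ℛ′⊆S , cℛ′ , saturated) =
      ℛ′ , ℛ⊆ℛ′ , ℛ′⊆S , cℛ′ , λ where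
        (here refl) cx∷ℛ′ → contradiction (consistent-antitone (∷⁺ʳ x ℛ⊆ℛ′) cx∷ℛ′) ¬cx∷ℛ
        (there β∈xs) → saturated β∈xs

  saturatingExtension⇒repair : ∀ {ℛ} → SaturatingExtension S ℛ →
                               Σ ABox λ ℛ′ → ℛ ⊆ ℛ′ × IsRepair T S ℛ′
  saturatingExtension⇒repair (ℛ′ , ℛ⊆ℛ′ , ℛ′⊆S , cℛ′ , saturated) =
    ℛ′ , ℛ⊆ℛ′ , ℛ′⊆S , cℛ′ , λ ℛ″ ℛ′⊆ℛ″ ℛ″⊆S cℛ″ β∈ℛ″ →
      saturated (ℛ″⊆S β∈ℛ″) (consistent-antitone (∈-∷⁺ʳ β∈ℛ″ ℛ′⊆ℛ″) cℛ″)

  ¬¬-extendToRepair : ∀ {ℛ} → ℛ ⊆ S → Consistent T ℛ →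
                      ¬ ¬ (Σ ABox λ ℛ′ → ℛ ⊆ ℛ′ × IsRepair T S ℛ′)
  ¬¬-extendToRepair ℛ⊆S cℛ = ¬¬-map saturatingExtension⇒repair (saturate S _ ⊆-refl ℛ⊆S cℛ)

-- Classically: α belongs to some conflict of 𝒜 ∪ {α}.
ContradictsConsistentSubset : TBox → ABox → Assertion → Set₁
ContradictsConsistentSubset T 𝒜 α =
  Σ ABox λ 𝒞 → 𝒞 ⊆ 𝒜 × Consistent T 𝒞 × Inconsistent T (α ∷ 𝒞)

contradictsConsistentSubset-mono : ∀ {T 𝒜 𝒜′ α} → 𝒜 ⊆ 𝒜′ →
  ContradictsConsistentSubset T 𝒜 α → ContradictsConsistentSubset T 𝒜′ α
contradictsConsistentSubset-mono 𝒜⊆𝒜′ (𝒞 , 𝒞⊆𝒜 , c𝒞 , ¬cα∷𝒞) = 𝒞 , ⊆-trans 𝒞⊆𝒜 𝒜⊆𝒜′ , c𝒞 , ¬cα∷𝒞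

contradictsConsistentSubset⇒¬ARentails : ∀ {T S α} →
  ContradictsConsistentSubset T S α → ¬ ARentails T S α
contradictsConsistentSubset⇒¬ARentails (𝒞 , 𝒞⊆S , c𝒞 , ¬cα∷𝒞) ⊨α =
  ¬¬-extendToRepair _ _ 𝒞⊆S c𝒞 λ where
    (ℛ , 𝒞⊆ℛ , repair@(_ , (I , I⊨T , I⊨ℛ) , _)) →
      ¬cα∷𝒞 (I , I⊨T , ⊨α ℛ repair I (I⊨T , I⊨ℛ) ∷ anti-mono 𝒞⊆ℛ I⊨ℛ)

isConflict-transfer : ∀ {T 𝒜 𝒜′ 𝒞} → 𝒞 ⊆ 𝒜′ → IsConflict T 𝒜 𝒞 → IsConflict T 𝒜′ 𝒞
isConflict-transfer 𝒞⊆𝒜′ (_ , ¬c𝒞 , minimal) = 𝒞⊆𝒜′ , ¬c𝒞 , minimal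

module _ {T 𝒜 α} (¬contradicts : ¬ ContradictsConsistentSubset T 𝒜 α) where

  ∉-conflict : ∀ {𝒞} → IsConflict T (𝒜 ++ [ α ]) 𝒞 → α ∉ 𝒞
  ∉-conflict {𝒞} (𝒞⊆𝒜α , ¬c𝒞 , minimal) α∈𝒞 = ¬¬-excluded-middle λ where
      (no ¬c𝒟) → proj₂ (∈-filter⁻ ≢α? {xs = 𝒞} (minimal 𝒟 𝒟⊆𝒞 ¬c𝒟 α∈𝒞)) refl
      (yes c𝒟) → ¬contradicts (𝒟 , 𝒟⊆𝒜 , c𝒟 , λ cα∷𝒟 → ¬c𝒞 (consistent-antitone 𝒞⊆α∷𝒟 cα∷𝒟))
    where
    ≢α? : Decidable (_≢ α)
    ≢α? β = ¬? (β ≟ α)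

    𝒟 : ABox
    𝒟 = filter ≢α? 𝒞

    𝒟⊆𝒞 : 𝒟 ⊆ 𝒞
    𝒟⊆𝒞 = proj₁ ∘ ∈-filter⁻ ≢α?

    𝒟⊆𝒜 : 𝒟 ⊆ 𝒜
    𝒟⊆𝒜 β∈𝒟 = let β∈𝒞 , β≢α = ∈-filter⁻ ≢α? β∈𝒟 in ∈-++-[]⁻ 𝒜 (𝒞⊆𝒜α β∈𝒞) β≢α

    𝒞⊆α∷𝒟 : 𝒞 ⊆ α ∷ 𝒟
    𝒞⊆α∷𝒟 {β} β∈𝒞 with β ≟ α
    ... | yes refl = here refl
    ... | no β≢α = there (∈-filter⁺ ≢α? β∈𝒞 β≢α)

  conflictConfining : ConflictConfining T 𝒜 [ α ]
  conflictConfining = restrict , extend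
    where
    restrict : ∀ 𝒞 → IsConflict T (𝒜 ++ [ α ]) 𝒞 → Σ ABox λ 𝒞′ → IsConflict T 𝒜 𝒞′ × 𝒞 ≐ 𝒞′
    restrict 𝒞 conflict@(𝒞⊆𝒜α , _) =
      𝒞 , isConflict-transfer 𝒞⊆𝒜 conflict , ⊆-refl , ⊆-refl
      where
      𝒞⊆𝒜 : 𝒞 ⊆ 𝒜
      𝒞⊆𝒜 β∈𝒞 = ∈-++-[]⁻ 𝒜 (𝒞⊆𝒜α β∈𝒞) λ { refl → ∉-conflict conflict β∈𝒞 }

    extend : ∀ 𝒞 → IsConflict T 𝒜 𝒞 → Σ ABox λ 𝒞′ → IsConflict T (𝒜 ++ [ α ]) 𝒞′ × 𝒞 ≐ 𝒞′
    extend 𝒞 conflict@(𝒞⊆𝒜 , _) =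
      𝒞 , isConflict-transfer (⊆-trans 𝒞⊆𝒜 (xs⊆xs++ys 𝒜 [ α ])) conflict , ⊆-refl , ⊆-refl

mainTheorem2 : (T : TBox) (𝒜 : ABox) (A : ConceptName) (a : IndName)
    → Inconsistent T 𝒜
    → ¬ ARentails T 𝒜 (conceptAssertion A a)
    → ¬ ConflictConfining T 𝒜 [ conceptAssertion A a ]
    → (ℋ : ABox) → ¬ IsARHypothesis T 𝒜 (conceptAssertion A a) ℋ
mainTheorem2 T 𝒜 A a _ _ ¬confining ℋ hypothesis = ¬¬-excluded-middle λ where
  (yes contradicts) → contradictsConsistentSubset⇒¬ARentails
                        (contradictsConsistentSubset-mono (xs⊆xs++ys 𝒜 ℋ) contradicts) hypothesis
  (no ¬contradicts) → ¬confining (conflictConfining ¬contradicts)
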